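{- (Constructively.) For a countable signature, let $\mathcal M$ be a model admitting a Henkin environment $\rho:\mathbb N\to\mathcal M$. Then there is a model $\mathcal N$ whose domain is the (countable) type $\mathbb T$ of terms, together with an elementary embedding $\mathcal N\to\mathcal M$.
   Context: First-order logic without equality over a signature with countably many function and relation symbols; variables are de Bruijn indices $\mathsf x_n$, terms $\mathbb T$, formulas built from $\dot\bot$, atoms, $\dot\to,\dot\land,\dot\lor,\dot\forall,\dot\exists$ (a quantifier binds index $0$). A model is a type with interpretations of symbols; $\mathcal M\vDash_\rho\phi$ is Tarski satisfaction for $\rho:\mathbb N\to\mathcal M$, and for $a\in\mathcal M$, $\mathcal M\vDash_\rho\phi[a]$ means $\phi$ satisfied in the environment sending $\mathsf x_0\mapsto a$ and $\mathsf x_{k+1}\mapsto\rho\,k$ (so $\mathcal M\vDash_\rho\dot\forall\phi$ iff $\forall a.\,\mathcal M\vDash_\rho\phi[a]$). An environment $\rho:\mathbb N\to\mathcal M$ is a Henkin environment if for every formula $\phi$: there is $n$ with $\mathcal M\vDash_\rho\phi[\rho\,n]\to\mathcal M\vDash_\rho\dot\forall\phi$, and there is $n$ with $\mathcal M\vDash_\rho\dot\exists\phi\to\mathcal M\vDash_\rho\phi[\rho\,n]$. A map $h:\mathcal N\to\mathcal M$ is an elementary embedding if for all environments $\sigma:\mathbb N\to\mathcal N$ and formulas $\phi$, $\mathcal N\vDash_\sigma\phi\leftrightarrow\mathcal M\vDash_{h\circ\sigma}\phi$. -}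

module Defs where

open import Data.Nat using (ℕ; zero; suc)
open import Data.Vec using (Vec; []; _∷_)
open import Data.Product using (Σ; _×_; _,_)
open import Data.Sum using (_⊎_)
open import Data.Empty using (⊥)
open import Function using (_∘_)
open import Function.Definitions using (Injective)
open import Relation.Binary.PropositionalEquality using (_≡_)

record Signature : Set₁ where
  field
    Func  : Set
    Pred  : Set
    arF   : Func → ℕ
    arP   : Pred → ℕ

Countable : Signature → Set
Countable S =
  Σ (Func → ℕ) (λ e → Injective _≡_ _≡_ e) ×
  Σ (Pred → ℕ) (λ e → Injective _≡_ _≡_ e)
  where open Signature S

module FOL (S : Signature) where
  open Signature S

  data Term : Set where
    var  : ℕ → Term
    func : (f : Func) → Vec Term (arF f) → Term

  -- Formulas (quantifiers bind index 0).
  data Form : Set where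
    ⊥̇    : Form
    atom : (P : Pred) → Vec Term (arP P) → Form
    _→̇_  : Form → Form → Form
    _∧̇_  : Form → Form → Form
    _∨̇_  : Form → Form → Form
    ∀̇    : Form → Form
    ∃̇    : Form → Form

  record Model (D : Set) : Set₁ where
    field
      iF : (f : Func) → Vec D (arF f) → D
      iP : (P : Pred) → Vec D (arP P) → Set

  _∷ₑ_ : {D : Set} → D → (ℕ → D) → ℕ → D
  (a ∷ₑ ρ) zero    = a
  (a ∷ₑ ρ) (suc k) = ρ k

  module _ {D : Set} (M : Model D) where
    open Model M

    mutual
      eval : (ℕ → D) → Term → D
      eval ρ (var n)     = ρ n
      eval ρ (func f ts) = iF f (evalVec ρ ts)

      evalVec : ∀ {n} → (ℕ → D) → Vec Term n → Vec D n
      evalVec ρ []       = []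
      evalVec ρ (t ∷ ts) = eval ρ t ∷ evalVec ρ ts

    sat : (ℕ → D) → Form → Set
    sat ρ ⊥̇          = ⊥
    sat ρ (atom P ts) = iP P (evalVec ρ ts)
    sat ρ (φ →̇ ψ)    = sat ρ φ → sat ρ ψ
    sat ρ (φ ∧̇ ψ)    = sat ρ φ × sat ρ ψ
    sat ρ (φ ∨̇ ψ)    = sat ρ φ ⊎ sat ρ ψ
    sat ρ (∀̇ φ)      = (a : D) → sat (a ∷ₑ ρ) φ
    sat ρ (∃̇ φ)      = Σ D (λ a → sat (a ∷ₑ ρ) φ)

    satAt : (ℕ → D) → Form → D → Set
    satAt ρ φ a = sat (a ∷ₑ ρ) φ

    Henkin : (ℕ → D) → Set
    Henkin ρ = (φ : Form) →
      Σ ℕ (λ n → satAt ρ φ (ρ n) → sat ρ (∀̇ φ)) ×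
      Σ ℕ (λ n → sat ρ (∃̇ φ) → satAt ρ φ (ρ n))

  Elementary : {D E : Set} → Model E → Model D → (E → D) → Set
  Elementary N M h = (σ : ℕ → _) (φ : Form) →
    (sat N σ φ → sat M (h ∘ σ) φ) × (sat M (h ∘ σ) φ → sat N σ φ)

module Submission where

-- Interpret a term t as its value ⟦t⟧ρ in M and let an atom hold in the term model iff it holds
-- of the values of its arguments.  Then t ↦ ⟦t⟧ρ preserves truth by induction on formulas: at a
-- quantifier, the term model only offers terms as witnesses, but the Henkin property of ρ
-- (applied to the formula with the current environment substituted in) says that the value
-- ρ n = ⟦xₙ⟧ρ of some variable is always a good enough witness in M.

open import Defs
open import Data.Nat using (ℕ; zero; suc)
open import Data.Product using (Σ; _,_; proj₁; proj₂)
open import Data.Product.Function.NonDependent.Propositional using (_×-⇔_)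
open import Data.Sum.Function.Propositional using (_⊎-⇔_)
open import Data.Vec using (Vec; []; _∷_)
open import Function using (_∘_; _⇔_; mk⇔; Equivalence)
open import Function.Related.TypeIsomorphisms using (→-cong-⇔)
import Function.Properties.Equivalence as ⇔
open import Relation.Binary.PropositionalEquality
  using (_≡_; _≗_; refl; sym; trans; cong; cong₂; subst)

open Equivalence using (to; from)

Π-cong-⇔ : {A : Set} {P Q : A → Set} → (∀ a → P a ⇔ Q a) → ((a : A) → P a) ⇔ ((a : A) → Q a)
Π-cong-⇔ P⇔Q = mk⇔ (λ f a → to (P⇔Q a) (f a)) (λ g a → from (P⇔Q a) (g a))

Σ-cong-⇔ : {A : Set} {P Q : A → Set} → (∀ a → P a ⇔ Q a) → Σ A P ⇔ Σ A Q
Σ-cong-⇔ P⇔Q = mk⇔ (λ (a , p) → a , to (P⇔Q a) p) (λ (a , q) → a , from (P⇔Q a) q)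

subst-⇔ : {A : Set} (P : A → Set) {x y : A} → x ≡ y → P x ⇔ P y
subst-⇔ P x≡y = mk⇔ (subst P x≡y) (subst P (sym x≡y))

module TermModel (S : Signature) where
  open Signature S
  open FOL S

  ∘-∷ₑ : {A B : Set} (f : A → B) {σ : ℕ → A} {τ : ℕ → B} (x : A) →
         f ∘ σ ≗ τ → f ∘ (x ∷ₑ σ) ≗ f x ∷ₑ τ
  ∘-∷ₑ f x f∘σ≗τ zero    = refl
  ∘-∷ₑ f x f∘σ≗τ (suc k) = f∘σ≗τ k

  mutual
    substTerm : (ℕ → Term) → Term → Term
    substTerm σ (var n)     = σ n
    substTerm σ (func f ts) = func f (substVec σ ts)

    substVec : ∀ {n} → (ℕ → Term) → Vec Term n → Vec Term n
    substVec σ []       = []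
    substVec σ (t ∷ ts) = substTerm σ t ∷ substVec σ ts

  liftSubst : (ℕ → Term) → ℕ → Term
  liftSubst σ zero    = var zero
  liftSubst σ (suc k) = substTerm (var ∘ suc) (σ k)

  substForm : (ℕ → Term) → Form → Form
  substForm σ ⊥̇           = ⊥̇
  substForm σ (atom P ts) = atom P (substVec σ ts)
  substForm σ (φ →̇ ψ)     = substForm σ φ →̇ substForm σ ψ
  substForm σ (φ ∧̇ ψ)     = substForm σ φ ∧̇ substForm σ ψ
  substForm σ (φ ∨̇ ψ)     = substForm σ φ ∨̇ substForm σ ψ
  substForm σ (∀̇ φ)       = ∀̇ (substForm (liftSubst σ) φ)
  substForm σ (∃̇ φ)       = ∃̇ (substForm (liftSubst σ) φ)

  module _ {D : Set} (M : Model D) where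
    open Model M

    mutual
      eval-substTerm : ∀ {ρ τ : ℕ → D} {σ} → eval M ρ ∘ σ ≗ τ →
                       ∀ t → eval M ρ (substTerm σ t) ≡ eval M τ t
      eval-substTerm ρσ≗τ (var n)     = ρσ≗τ n
      eval-substTerm ρσ≗τ (func f ts) = cong (iF f) (evalVec-substVec ρσ≗τ ts)

      evalVec-substVec : ∀ {ρ τ : ℕ → D} {σ} → eval M ρ ∘ σ ≗ τ →
                         ∀ {n} (ts : Vec Term n) → evalVec M ρ (substVec σ ts) ≡ evalVec M τ ts
      evalVec-substVec ρσ≗τ []       = refl
      evalVec-substVec ρσ≗τ (t ∷ ts) =
        cong₂ _∷_ (eval-substTerm ρσ≗τ t) (evalVec-substVec ρσ≗τ ts)

    eval-liftSubst : ∀ {ρ τ : ℕ → D} {σ} → eval M ρ ∘ σ ≗ τ →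
                     ∀ a → eval M (a ∷ₑ ρ) ∘ liftSubst σ ≗ a ∷ₑ τ
    eval-liftSubst ρσ≗τ a zero          = refl
    eval-liftSubst {σ = σ} ρσ≗τ a (suc k) =
      trans (eval-substTerm (λ _ → refl) (σ k)) (ρσ≗τ k)

    sat-substForm : ∀ {ρ τ : ℕ → D} {σ} → eval M ρ ∘ σ ≗ τ →
                    ∀ φ → sat M ρ (substForm σ φ) ⇔ sat M τ φ
    sat-substForm ρσ≗τ ⊥̇           = ⇔.refl
    sat-substForm ρσ≗τ (atom P ts) = subst-⇔ (iP P) (evalVec-substVec ρσ≗τ ts)
    sat-substForm ρσ≗τ (φ →̇ ψ)     = →-cong-⇔ (sat-substForm ρσ≗τ φ) (sat-substForm ρσ≗τ ψ)
    sat-substForm ρσ≗τ (φ ∧̇ ψ)     = sat-substForm ρσ≗τ φ ×-⇔ sat-substForm ρσ≗τ ψ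
    sat-substForm ρσ≗τ (φ ∨̇ ψ)     = sat-substForm ρσ≗τ φ ⊎-⇔ sat-substForm ρσ≗τ ψ
    sat-substForm ρσ≗τ (∀̇ φ)       =
      Π-cong-⇔ λ a → sat-substForm (eval-liftSubst ρσ≗τ a) φ
    sat-substForm ρσ≗τ (∃̇ φ)       =
      Σ-cong-⇔ λ a → sat-substForm (eval-liftSubst ρσ≗τ a) φ

  termModel : ((P : Pred) → Vec Term (arP P) → Set) → Model Term
  termModel I = record { iF = func ; iP = I }

  mutual
    eval-termModel : ∀ I σ t → eval (termModel I) σ t ≡ substTerm σ t
    eval-termModel I σ (var n)     = refl
    eval-termModel I σ (func f ts) = cong (func f) (evalVec-termModel I σ ts)

    evalVec-termModel : ∀ I σ {n} (ts : Vec Term n) →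
                        evalVec (termModel I) σ ts ≡ substVec σ ts
    evalVec-termModel I σ []       = refl
    evalVec-termModel I σ (t ∷ ts) =
      cong₂ _∷_ (eval-termModel I σ t) (evalVec-termModel I σ ts)

  module HenkinTermModel {D : Set} (M : Model D) (ρ : ℕ → D) (henkin : Henkin M ρ) where
    open Model M

    N : Model Term
    N = termModel (λ P ts → iP P (evalVec M ρ ts))

    h : Term → D
    h = eval M ρ

    -- The Henkin property of ρ transfers to every environment h ∘ σ: apply it to φ with σ
    -- substituted in.
    module _ {σ : ℕ → Term} {τ : ℕ → D} (hσ≗τ : h ∘ σ ≗ τ) (φ : Form) where
      private
        satAt-substForm : ∀ a → satAt M ρ (substForm (liftSubst σ) φ) a ⇔ sat M (a ∷ₑ τ) φ
        satAt-substForm a = sat-substForm M (eval-liftSubst M hσ≗τ a) φ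

      ∀̇-witness : Σ ℕ λ n → sat M (ρ n ∷ₑ τ) φ → sat M τ (∀̇ φ)
      ∀̇-witness with proj₁ (henkin (substForm (liftSubst σ) φ))
      ... | n , instance⇒∀ = n , λ φρn a →
        to (satAt-substForm a) (instance⇒∀ (from (satAt-substForm (ρ n)) φρn) a)

      ∃̇-witness : Σ ℕ λ n → sat M τ (∃̇ φ) → sat M (ρ n ∷ₑ τ) φ
      ∃̇-witness with proj₂ (henkin (substForm (liftSubst σ) φ))
      ... | n , ∃⇒instance = n , λ (a , φa) →
        to (satAt-substForm (ρ n)) (∃⇒instance (a , from (satAt-substForm a) φa))

    sat-N : ∀ {σ τ} → h ∘ σ ≗ τ → ∀ φ → sat N σ φ ⇔ sat M τ φ
    sat-N hσ≗τ ⊥̇           = ⇔.refl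
    sat-N {σ} hσ≗τ (atom P ts) = subst-⇔ (iP P)
      (trans (cong (evalVec M ρ) (evalVec-termModel _ σ ts)) (evalVec-substVec M hσ≗τ ts))
    sat-N hσ≗τ (φ →̇ ψ)     = →-cong-⇔ (sat-N hσ≗τ φ) (sat-N hσ≗τ ψ)
    sat-N hσ≗τ (φ ∧̇ ψ)     = sat-N hσ≗τ φ ×-⇔ sat-N hσ≗τ ψ
    sat-N hσ≗τ (φ ∨̇ ψ)     = sat-N hσ≗τ φ ⊎-⇔ sat-N hσ≗τ ψ
    sat-N {σ} {τ} hσ≗τ (∀̇ φ) with ∀̇-witness {σ} hσ≗τ φ
    ... | n , witness =
      mk⇔ (λ φ-all → witness (to (sat-N-∷ (var n)) (φ-all (var n))))
          (λ φ-all t → from (sat-N-∷ t) (φ-all (h t)))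
      where
      sat-N-∷ : ∀ t → sat N (t ∷ₑ σ) φ ⇔ sat M (h t ∷ₑ τ) φ
      sat-N-∷ t = sat-N (∘-∷ₑ h t hσ≗τ) φ
    sat-N {σ} {τ} hσ≗τ (∃̇ φ) with ∃̇-witness {σ} hσ≗τ φ
    ... | n , witness =
      mk⇔ (λ (t , φt) → h t , to (sat-N-∷ t) φt)
          (λ φ-some → var n , from (sat-N-∷ (var n)) (witness φ-some))
      where
      sat-N-∷ : ∀ t → sat N (t ∷ₑ σ) φ ⇔ sat M (h t ∷ₑ τ) φ
      sat-N-∷ t = sat-N (∘-∷ₑ h t hσ≗τ) φ

    h-elementary : Elementary N M h
    h-elementary σ φ = to (sat-N {σ} (λ _ → refl) φ) , from (sat-N {σ} (λ _ → refl) φ)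

theorem3p5 : (S : Signature) → Countable S →
    (D : Set) (M : FOL.Model S D) (ρ : ℕ → D) → FOL.Henkin S M ρ →
    Σ (FOL.Model S (FOL.Term S)) (λ N →
    Σ (FOL.Term S → D) (λ h → FOL.Elementary S N M h))
theorem3p5 S _ D M ρ henkin = N , h , h-elementary
  where open TermModel.HenkinTermModel S M ρ henkin
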